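{- Let $W_n$ be the wheel graph on $n+1$ vertices. If $n$ is even, then the total domination number of $W_n$ can increase (by deleting edges) by at most $n-2$, and $$b_t^{n-2}(W_n)=2n-\frac{n+4}{2}.$$ If $n$ is odd, then the total domination number can increase by at most $n-1$, and $$b_t^{n-1}(W_n)=2n-\frac{n+1}{2}.$$
   Context: The wheel $W_n$ is the graph on $n+1$ vertices obtained by joining a single vertex to every vertex of a cycle $C_n$; it has $2n$ edges and $\gamma_t(W_n)=2$. A total dominating set of a graph without isolated vertices is a vertex set $S$ such that every vertex is adjacent to some vertex of $S$; $\gamma_t(G)$ is the minimum size of such a set. The $k$-total bondage number $b_t^k(G)$ is the minimum number of edges that must be deleted from $G$ so that the resulting graph (required to have no isolated vertices) has total domination number at least $\gamma_t(G)+k$. -}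

module Defs where

open import Data.Nat using (ℕ; zero; suc; _+_; _<?_)
open import Data.Fin using (Fin; zero; suc; toℕ; fromℕ<; splitAt)
open import Data.Fin.Subset using (Subset; _∈_; _∉_; ∣_∣; ⊥)
open import Data.Sum using (_⊎_; inj₁; inj₂)
open import Data.Product using (_×_; _,_; ∃-syntax)
open import Relation.Nullary using (yes; no)
open import Relation.Binary.PropositionalEquality using (_≡_)

Adjacency : ℕ → Set₁
Adjacency V = Fin V → Fin V → Set

NoIsolated : {V : ℕ} → Adjacency V → Set
NoIsolated {V} A = (v : Fin V) → ∃[ u ] A v u

IsTDS : {V : ℕ} → Adjacency V → Subset V → Set
IsTDS {V} A S = (v : Fin V) → ∃[ u ] (u ∈ S × A v u)

IsGammaT : {V : ℕ} → Adjacency V → ℕ → Set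
IsGammaT A m = (∃[ S ] (IsTDS A S × ∣ S ∣ ≡ m)) × (∀ S → IsTDS A S → m Data.Nat.≤ ∣ S ∣)

-- The wheel W_n: vertices Fin (suc n); vertex 0 is the hub, suc i
-- (i : Fin n) are the rim vertices, cyclically ordered.

next : {n : ℕ} → Fin n → Fin n
next {suc m} i with suc (toℕ i) <? suc m
... | yes p = fromℕ< p
... | no _  = zero

-- The 2n edges of W_n are indexed by Fin (n + n):
-- the first n are spokes (hub – suc i), the last n are rim edges
-- (suc i – suc (next i)).
ends : (n : ℕ) → Fin (n + n) → Fin (suc n) × Fin (suc n)
ends n e with splitAt n e
... | inj₁ i = zero , suc i
... | inj₂ i = suc i , suc (next i)

WheelMinus : (n : ℕ) → Subset (n + n) → Adjacency (suc n)
WheelMinus n D u v =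
  ∃[ e ] (e ∉ D × ((ends n e ≡ (u , v)) ⊎ (ends n e ≡ (v , u))))

Wheel : (n : ℕ) → Adjacency (suc n)
Wheel n = WheelMinus n ⊥

GoodDeletion : (n k : ℕ) → Subset (n + n) → Set
GoodDeletion n k D =
  NoIsolated (WheelMinus n D) ×
  (∀ g → IsGammaT (Wheel n) g →
     ∀ S → IsTDS (WheelMinus n D) S → g + k Data.Nat.≤ ∣ S ∣)

IsBondageT : (n k b : ℕ) → Set
IsBondageT n k b =
  (∃[ D ] (GoodDeletion n k D × ∣ D ∣ ≡ b)) ×
  (∀ D → GoodDeletion n k D → b Data.Nat.≤ ∣ D ∣)

-- "γ_t(W_n) can increase by at most k": for every deletion D leaving no
-- isolated vertices, W_n − D has a TDS of size ≤ γ_t(W_n) + k.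
IncreaseAtMost : (n k : ℕ) → Set
IncreaseAtMost n k =
  ∀ D → NoIsolated (WheelMinus n D) →
  ∀ g → IsGammaT (Wheel n) g →
  ∃[ S ] (IsTDS (WheelMinus n D) S × ∣ S ∣ Data.Nat.≤ g + k)

module Submission where

-- Deleting a set D of edges from W_n leaves a graph H on V = n + 1 vertices with
-- |D| = 2n − e(H) and 2 e(H) = Σ deg. If every total dominating set of H is all of
-- V(H), then for each p some vertex has p as its only neighbour; applying this twice
-- shows that every degree is 1, so 2 e(H) ≤ V. If every total dominating set misses
-- at most one vertex, then for all p ≠ q some vertex has all its neighbours in {p, q};
-- a case analysis on leaves and their supports shows that H is a matching plus at
-- most one P₃ or K₃, so 2 e(H) ≤ V + 3. The bounds are attained by keeping a perfect
-- matching (n odd) or a triangle through the hub plus a perfect matching of the other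
-- rim vertices (n even). For the increase: V(H) itself is a total dominating set, and
-- when V is odd one vertex can be dropped from it, since otherwise H would be a
-- perfect matching.

open import Defs

open import Data.Bool using (true; false; not; if_then_else_)
open import Data.Empty using (⊥; ⊥-elim)
open import Data.Fin using (Fin; zero; suc; toℕ; fromℕ<; inject₁; splitAt; join; _↑ˡ_; _↑ʳ_)
open import Data.Fin.Properties
  using (_≟_; any?; all?; ¬∀⟶∃¬; toℕ-fromℕ<; toℕ-inject₁; toℕ<n; toℕ-injective; join-splitAt; splitAt-↑ˡ; splitAt-↑ʳ)
  renaming (suc-injective to Fin-suc-injective)
open import Data.Fin.Subset using (Subset; _∈_; _∉_; _⊆_; ∣_∣; ⊤; ∁; ⁅_⁆; _-_) renaming (⊥ to ∅)
open import Data.Fin.Subset.Properties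
  using (_∈?_; ∉⊥; ∈⊤; x∈∁p⇒x∉p; x∉p⇒x∈∁p; x≢y⇒x∉⁅y⁆; x∉⁅y⁆⇒x≢y; x∈p∧x≢y⇒x∈p-y;
         ∣p∣≤n; ∣⊥∣≡0; ∣⊤∣≡n; ∣⁅x⁆∣≡1; ∣∁p∣≡n∸∣p∣; x∈p⇒∣p-x∣<∣p∣; p⊆q⇒∣p∣≤∣q∣)
import Data.Nat as ℕ
open import Data.Nat using (ℕ; zero; suc; _+_; _*_; _∸_; _≤_; _<_; _/_; z≤n; s≤s; _<?_; parity)
open import Data.Nat.Divisibility using (_∣_; divides; ∣1⇒≡1; ∣m+n∣m⇒∣n; m∣m*n)
open import Data.Nat.DivMod using (m*n/n≡m; /-monoˡ-≤)
open import Data.Nat.Properties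
  using (module ≤-Reasoning; ≤-reflexive; ≤-trans; ≤-antisym; ≤-pred; ≤-<-trans; <-irrefl; <⇒≢; <⇒≱; ≤∧≢⇒<; ≮⇒≥;
         1+n≰n; 1+n≢n; n≤1+n; n<1+n; m<n⇒m<1+n; m≤m+n; m≤n+m; suc-injective; +-mono-≤; +-identityʳ; +-assoc;
         +-comm; +-suc; *-comm; ∸-monoʳ-≤; m∸[m∸n]≡n; +-*-semiring)
open import Algebra.Properties.Semiring.Sum +-*-semiring
  using (sum; sum-syntax; ∑-distrib-+; ∑-comm; sum-cong-≗; sum-replicate-zero; *-distribˡ-sum)
open import Data.Parity.Base using (Parity; 0ℙ; 1ℙ; _⁻¹)
open import Data.Parity.Properties using (p≢p⁻¹; suc-homo-⁻¹) renaming (_≟_ to _≟ℙ_)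
open import Data.Product using (_×_; _,_; ∃-syntax; proj₁; proj₂; swap)
open import Data.Product.Properties using (≡-dec; ,-injectiveˡ; ,-injectiveʳ)
open import Data.Sum using (_⊎_; inj₁; inj₂; [_,_]′) renaming (swap to ⊎-swap)
open import Data.Vec using ([]; _∷_; tabulate; here; there)
open import Data.Vec.Properties using (lookup∘tabulate; lookup⇒[]=; []=⇒lookup)
open import Function using (_∘_; id)
open import Relation.Binary.PropositionalEquality
  using (_≡_; _≢_; refl; sym; trans; cong; cong₂; subst; module ≡-Reasoning)
open import Relation.Nullary using (¬_; Dec; yes; no; does)
open import Relation.Nullary.Decidable
  using (_⊎-dec_; _×-dec_; _→-dec_; ¬?; decidable-stable; dec-true; dec-false)
open import Relation.Nullary.Negation using (contradiction)

private variable P Q R : Set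

𝟙 : Dec P → ℕ
𝟙 P? = if does P? then 1 else 0

𝟙-yes : (P? : Dec P) → P → 𝟙 P? ≡ 1
𝟙-yes (yes _) _ = refl
𝟙-yes (no ¬p) p = contradiction p ¬p

𝟙-no : (P? : Dec P) → ¬ P → 𝟙 P? ≡ 0
𝟙-no (yes p) ¬p = contradiction p ¬p
𝟙-no (no _) _ = refl

𝟙-mono : (P → Q) → (P? : Dec P) (Q? : Dec Q) → 𝟙 P? ≤ 𝟙 Q?
𝟙-mono f (yes p) Q? = ≤-reflexive (sym (𝟙-yes Q? (f p)))
𝟙-mono f (no _) Q? = z≤n

𝟙-cong : (P → Q) → (Q → P) → (P? : Dec P) (Q? : Dec Q) → 𝟙 P? ≡ 𝟙 Q?
𝟙-cong f g P? Q? = ≤-antisym (𝟙-mono f P? Q?) (𝟙-mono g Q? P?)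

𝟙-⊎-≤ : (P → Q ⊎ R) → (P? : Dec P) (Q? : Dec Q) (R? : Dec R) → 𝟙 P? ≤ 𝟙 Q? + 𝟙 R?
𝟙-⊎-≤ f (no _) Q? R? = z≤n
𝟙-⊎-≤ f (yes p) Q? R? with f p
... | inj₁ q = ≤-trans (≤-reflexive (sym (𝟙-yes Q? q))) (m≤m+n _ _)
... | inj₂ r = ≤-trans (≤-reflexive (sym (𝟙-yes R? r))) (m≤n+m _ _)

𝟙-⊎ : ¬ (Q × R) → (Q? : Dec Q) (R? : Dec R) → 𝟙 (Q? ⊎-dec R?) ≡ 𝟙 Q? + 𝟙 R?
𝟙-⊎ ¬qr (yes q) (yes r) = contradiction (q , r) ¬qr
𝟙-⊎ ¬qr (yes _) (no _) = refl
𝟙-⊎ ¬qr (no _) (yes _) = refl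
𝟙-⊎ ¬qr (no _) (no _) = refl

sum-mono : {n : ℕ} {f g : Fin n → ℕ} → (∀ i → f i ≤ g i) → sum f ≤ sum g
sum-mono {zero} _ = z≤n
sum-mono {suc n} f≤g = +-mono-≤ (f≤g zero) (sum-mono (λ i → f≤g (suc i)))

sum-zero : {n : ℕ} {f : Fin n → ℕ} → (∀ i → f i ≡ 0) → sum f ≡ 0
sum-zero {n} f≡0 = trans (sum-cong-≗ f≡0) (sum-replicate-zero n)

sum-ones : (n : ℕ) → ∑[ i < n ] 1 ≡ n
sum-ones zero = refl
sum-ones (suc n) = cong suc (sum-ones n)

sum-𝟙-≟ : {n : ℕ} (c : Fin n) → ∑[ u < n ] 𝟙 (u ≟ c) ≡ 1
sum-𝟙-≟ {suc n} zero = cong suc (sum-zero {n} (λ _ → refl))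
sum-𝟙-≟ {suc n} (suc c) = sum-𝟙-≟ {n} c

sum-𝟙-unique : {n : ℕ} {P : Fin n → Set} (P? : ∀ i → Dec (P i)) →
  (∀ {i j} → P i → P j → i ≡ j) → ∑[ i < n ] 𝟙 (P? i) ≡ 𝟙 (any? P?)
sum-𝟙-unique P? unique with any? P?
... | yes (i , p) = trans (sum-cong-≗ λ j → 𝟙-cong (λ q → unique q p) (λ { refl → p }) (P? j) (j ≟ i)) (sum-𝟙-≟ i)
... | no ¬∃ = sum-zero λ i → 𝟙-no (P? i) (λ p → ¬∃ (i , p))

∣p∣≡∑𝟙∈ : {n : ℕ} (p : Subset n) → ∣ p ∣ ≡ ∑[ i < n ] 𝟙 (i ∈? p)
∣p∣≡∑𝟙∈ [] = refl
∣p∣≡∑𝟙∈ (true ∷ p) = cong suc (∣p∣≡∑𝟙∈ p)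
∣p∣≡∑𝟙∈ (false ∷ p) = ∣p∣≡∑𝟙∈ p

∑[1+𝟙+𝟙+𝟙]≡n+3 : {n : ℕ} (x a b : Fin n) →
  ∑[ v < n ] (1 + 𝟙 (v ≟ x) + 𝟙 (v ≟ a) + 𝟙 (v ≟ b)) ≡ n + 3
∑[1+𝟙+𝟙+𝟙]≡n+3 {n} x a b = begin
  ∑[ v < n ] (1 + 𝟙 (v ≟ x) + 𝟙 (v ≟ a) + 𝟙 (v ≟ b))
    ≡⟨ ∑-distrib-+ (λ v → 1 + 𝟙 (v ≟ x) + 𝟙 (v ≟ a)) (λ v → 𝟙 (v ≟ b)) ⟩
  ∑[ v < n ] (1 + 𝟙 (v ≟ x) + 𝟙 (v ≟ a)) + ∑[ v < n ] 𝟙 (v ≟ b)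
    ≡⟨ cong (_+ ∑[ v < n ] 𝟙 (v ≟ b)) (∑-distrib-+ (λ v → 1 + 𝟙 (v ≟ x)) (λ v → 𝟙 (v ≟ a))) ⟩
  ∑[ v < n ] (1 + 𝟙 (v ≟ x)) + ∑[ v < n ] 𝟙 (v ≟ a) + ∑[ v < n ] 𝟙 (v ≟ b)
    ≡⟨ cong (λ m → m + ∑[ v < n ] 𝟙 (v ≟ a) + ∑[ v < n ] 𝟙 (v ≟ b)) (∑-distrib-+ (λ _ → 1) (λ v → 𝟙 (v ≟ x))) ⟩
  ∑[ v < n ] 1 + ∑[ v < n ] 𝟙 (v ≟ x) + ∑[ v < n ] 𝟙 (v ≟ a) + ∑[ v < n ] 𝟙 (v ≟ b)
    ≡⟨ cong₂ _+_ (cong₂ _+_ (cong₂ _+_ (sum-ones n) (sum-𝟙-≟ x)) (sum-𝟙-≟ a)) (sum-𝟙-≟ b) ⟩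
  n + 1 + 1 + 1
    ≡⟨ trans (cong (_+ 1) (+-assoc n 1 1)) (+-assoc n 2 1) ⟩
  n + 3 ∎
  where open ≡-Reasoning

module _ {n : ℕ} where

  x≢y⇒x∈∁⁅y⁆ : {x y : Fin n} → x ≢ y → x ∈ ∁ ⁅ y ⁆
  x≢y⇒x∈∁⁅y⁆ x≢y = x∉p⇒x∈∁p (x≢y⇒x∉⁅y⁆ x≢y)

  x∈∁⁅y⁆⇒x≢y : {x y : Fin n} → x ∈ ∁ ⁅ y ⁆ → x ≢ y
  x∈∁⁅y⁆⇒x≢y x∈ = x∉⁅y⁆⇒x≢y (x∈∁p⇒x∉p x∈)

  x∉∁⁅y⁆⇒x≡y : {x y : Fin n} → x ∉ ∁ ⁅ y ⁆ → x ≡ y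
  x∉∁⁅y⁆⇒x≡y {x} {y} x∉ with x ≟ y
  ... | yes x≡y = x≡y
  ... | no x≢y = contradiction (x≢y⇒x∈∁⁅y⁆ x≢y) x∉

  x∉∁⁅y⁆-z⇒x≡y⊎x≡z : {x y z : Fin n} → x ∉ ∁ ⁅ y ⁆ - z → x ≡ y ⊎ x ≡ z
  x∉∁⁅y⁆-z⇒x≡y⊎x≡z {x} {y} {z} x∉ with x ≟ z
  ... | yes x≡z = inj₂ x≡z
  ... | no x≢z = inj₁ (x∉∁⁅y⁆⇒x≡y λ x∈ → x∉ (x∈p∧x≢y⇒x∈p-y x∈ x≢z))

  ∣∁⁅x⁆∣≡n∸1 : (x : Fin n) → ∣ ∁ ⁅ x ⁆ ∣ ≡ n ∸ 1
  ∣∁⁅x⁆∣≡n∸1 x = trans (∣∁p∣≡n∸∣p∣ ⁅ x ⁆) (cong (n ∸_) (∣⁅x⁆∣≡1 x))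

  ∣∁⁅x⁆-y∣<n∸1 : {x y : Fin n} → y ≢ x → ∣ ∁ ⁅ x ⁆ - y ∣ < n ∸ 1
  ∣∁⁅x⁆-y∣<n∸1 {x} {y} y≢x =
    subst (∣ ∁ ⁅ x ⁆ - y ∣ <_) (∣∁⁅x⁆∣≡n∸1 x) (x∈p⇒∣p-x∣<∣p∣ (x≢y⇒x∈∁⁅y⁆ y≢x))

  ∁⁅x⁆⊆p⇒n∸1≤∣p∣ : {x : Fin n} {p : Subset n} → ∁ ⁅ x ⁆ ⊆ p → n ∸ 1 ≤ ∣ p ∣
  ∁⁅x⁆⊆p⇒n∸1≤∣p∣ {x} {p} ⊆p = subst (_≤ ∣ p ∣) (∣∁⁅x⁆∣≡n∸1 x) (p⊆q⇒∣p∣≤∣q∣ ⊆p)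

  ⊤⊆p⇒n≤∣p∣ : {p : Subset n} → ⊤ ⊆ p → n ≤ ∣ p ∣
  ⊤⊆p⇒n≤∣p∣ {p} ⊆p = subst (_≤ ∣ p ∣) (∣⊤∣≡n n) (p⊆q⇒∣p∣≤∣q∣ ⊆p)

  x≢y⇒2≤∣p∣ : {x y : Fin n} {p : Subset n} → x ≢ y → x ∈ p → y ∈ p → 2 ≤ ∣ p ∣
  x≢y⇒2≤∣p∣ x≢y x∈p y∈p =
    ≤-trans (s≤s (≤-trans (s≤s z≤n) (x∈p⇒∣p-x∣<∣p∣ y∈p-x))) (x∈p⇒∣p-x∣<∣p∣ x∈p)
    where y∈p-x = x∈p∧x≢y⇒x∈p-y y∈p (x≢y ∘ sym)

2*n/2≡n : (n : ℕ) → 2 * n / 2 ≡ n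
2*n/2≡n n = trans (cong (_/ 2) (*-comm 2 n)) (m*n/n≡m n 2)

halving-lower : {N k M : ℕ} → k ≤ N → 2 * (N ∸ k) ≤ M → N ∸ M / 2 ≤ k
halving-lower {N} {k} {M} k≤N 2c≤M = begin
  N ∸ M / 2        ≤⟨ ∸-monoʳ-≤ N (subst (_≤ M / 2) (2*n/2≡n (N ∸ k)) (/-monoˡ-≤ 2 2c≤M)) ⟩
  N ∸ (N ∸ k)      ≡⟨ m∸[m∸n]≡n k≤N ⟩
  k                ∎
  where open ≤-Reasoning

halving-upper : {N k M : ℕ} → k ≤ N → M ≤ 2 * (N ∸ k) → k ≤ N ∸ M / 2
halving-upper {N} {k} {M} k≤N M≤2c = begin
  k                ≡⟨ m∸[m∸n]≡n k≤N ⟨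
  N ∸ (N ∸ k)      ≤⟨ ∸-monoʳ-≤ N (subst (M / 2 ≤_) (2*n/2≡n (N ∸ k)) (/-monoˡ-≤ 2 M≤2c)) ⟩
  N ∸ M / 2        ∎
  where open ≤-Reasoning

2∣n⇒2*k≢1+n : {n : ℕ} → 2 ∣ n → (k : ℕ) → 2 * k ≢ suc n
2∣n⇒2*k≢1+n {n} 2∣n k 2k≡1+n with ∣1⇒≡1 (∣m+n∣m⇒∣n (subst (2 ∣_) (trans 2k≡1+n (+-comm 1 n)) (m∣m*n k)) 2∣n)
... | ()

parity[k*2]≡0ℙ : (k : ℕ) → parity (k * 2) ≡ 0ℙ
parity[k*2]≡0ℙ zero = refl
parity[k*2]≡0ℙ (suc k) = parity[k*2]≡0ℙ k

2∣⇒parity≡0ℙ : {n : ℕ} → 2 ∣ n → parity n ≡ 0ℙ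
2∣⇒parity≡0ℙ (divides k n≡k*2) = trans (cong parity n≡k*2) (parity[k*2]≡0ℙ k)

parity≡0ℙ⇒2∣ : (n : ℕ) → parity n ≡ 0ℙ → 2 ∣ n
parity≡0ℙ⇒2∣ zero _ = divides 0 refl
parity≡0ℙ⇒2∣ (suc (suc n)) p with parity≡0ℙ⇒2∣ n p
... | divides q n≡q*2 = divides (suc q) (cong (2 +_) n≡q*2)

parity-alternates : {j k : ℕ} {π : Parity} → k ≡ suc j → parity j ≡ π → ¬ parity k ≡ π
parity-alternates {j} {π = π} refl pj≡π pk≡π =
  p≢p⁻¹ π (sym (trans (cong _⁻¹ (sym pk≡π)) (trans (suc-homo-⁻¹ j) pj≡π)))

p≢q⇒p⁻¹≡q : {p q : Parity} → p ≢ q → p ⁻¹ ≡ q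
p≢q⇒p⁻¹≡q {0ℙ} {0ℙ} p≢q = ⊥-elim (p≢q refl)
p≢q⇒p⁻¹≡q {0ℙ} {1ℙ} _ = refl
p≢q⇒p⁻¹≡q {1ℙ} {0ℙ} _ = refl
p≢q⇒p⁻¹≡q {1ℙ} {1ℙ} p≢q = ⊥-elim (p≢q refl)

module Graph {V : ℕ} {A : Adjacency V}
  (A-sym : ∀ {u v} → A u v → A v u) (A-irrefl : ∀ {u} → ¬ A u u)
  (A? : ∀ u v → Dec (A u v)) where

  private variable a b c d p q s t u v w x y : Fin V

  N[_]⊆⁅_⁆ : Fin V → Fin V → Set
  N[ w ]⊆⁅ p ⁆ = ∀ u → A w u → u ≡ p

  N[_]⊆⁅_⁆∪⁅_⁆ : Fin V → Fin V → Fin V → Set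
  N[ w ]⊆⁅ p ⁆∪⁅ q ⁆ = ∀ u → A w u → u ≡ p ⊎ u ≡ q

  degree : Fin V → ℕ
  degree v = ∑[ u < V ] 𝟙 (A? v u)

  degree≤1 : N[ v ]⊆⁅ c ⁆ → degree v ≤ 1
  degree≤1 {v} {c} N⊆ = begin
    degree v                ≤⟨ sum-mono (λ u → 𝟙-mono (N⊆ u) (A? v u) (u ≟ c)) ⟩
    ∑[ u < V ] 𝟙 (u ≟ c)   ≡⟨ sum-𝟙-≟ c ⟩
    1                       ∎
    where open ≤-Reasoning

  degree≤2 : N[ v ]⊆⁅ c ⁆∪⁅ d ⁆ → degree v ≤ 2
  degree≤2 {v} {c} {d} N⊆ = begin
    degree v                                       ≤⟨ sum-mono (λ u → 𝟙-⊎-≤ (N⊆ u) (A? v u) (u ≟ c) (u ≟ d)) ⟩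
    ∑[ u < V ] (𝟙 (u ≟ c) + 𝟙 (u ≟ d))             ≡⟨ ∑-distrib-+ (λ u → 𝟙 (u ≟ c)) (λ u → 𝟙 (u ≟ d)) ⟩
    ∑[ u < V ] 𝟙 (u ≟ c) + ∑[ u < V ] 𝟙 (u ≟ d)   ≡⟨ cong₂ _+_ (sum-𝟙-≟ c) (sum-𝟙-≟ d) ⟩
    2                                              ∎
    where open ≤-Reasoning

  degree≥1 : A v u → 1 ≤ degree v
  degree≥1 {v} {u} vu = begin
    1                       ≡⟨ sum-𝟙-≟ u ⟨
    ∑[ w < V ] 𝟙 (w ≟ u)   ≤⟨ sum-mono (λ w → 𝟙-mono (λ { refl → vu }) (w ≟ u) (A? v w)) ⟩
    degree v                ∎
    where open ≤-Reasoning

  degree≥2 : a ≢ b → A v a → A v b → 2 ≤ degree v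
  degree≥2 {a} {b} {v} a≢b va vb = begin
    2
      ≡⟨ cong₂ _+_ (sum-𝟙-≟ a) (sum-𝟙-≟ b) ⟨
    ∑[ u < V ] 𝟙 (u ≟ a) + ∑[ u < V ] 𝟙 (u ≟ b)
      ≡⟨ ∑-distrib-+ (λ u → 𝟙 (u ≟ a)) (λ u → 𝟙 (u ≟ b)) ⟨
    ∑[ u < V ] (𝟙 (u ≟ a) + 𝟙 (u ≟ b))
      ≡⟨ sum-cong-≗ (λ u → 𝟙-⊎ (λ { (refl , refl) → a≢b refl }) (u ≟ a) (u ≟ b)) ⟨
    ∑[ u < V ] 𝟙 ((u ≟ a) ⊎-dec (u ≟ b))
      ≤⟨ sum-mono (λ u → 𝟙-mono (λ { (inj₁ refl) → va ; (inj₂ refl) → vb }) ((u ≟ a) ⊎-dec (u ≟ b)) (A? v u)) ⟩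
    degree v
      ∎
    where open ≤-Reasoning

  IsTDS? : (S : Subset V) → Dec (IsTDS A S)
  IsTDS? S = all? λ v → any? λ u → (u ∈? S) ×-dec A? v u

  undominated : {S : Subset V} → ¬ IsTDS A S → ∃[ w ] (∀ u → A w u → u ∉ S)
  undominated {S} ¬tds with ¬∀⟶∃¬ V _ (λ v → any? λ u → (u ∈? S) ×-dec A? v u) ¬tds
  ... | w , ¬dominated = w , λ u wu u∈S → ¬dominated (u , u∈S , wu)

  2≤∣TDS∣ : {S : Subset V} → Fin V → IsTDS A S → 2 ≤ ∣ S ∣
  2≤∣TDS∣ v tds with tds v
  ... | u , u∈S , _ with tds u
  ...   | u′ , u′∈S , uu′ = x≢y⇒2≤∣p∣ (λ { refl → A-irrefl uu′ }) u∈S u′∈S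

  -- Without isolated vertices, w is a leaf at p, i.e. p is a support vertex.
  Support : Fin V → Set
  Support p = ∃[ w ] N[ w ]⊆⁅ p ⁆

  Support? : ∀ p → Dec (Support p)
  Support? p = any? λ w → all? λ u → A? w u →-dec u ≟ p

  Blocked : Fin V → Fin V → Set
  Blocked p q = ∃[ w ] N[ w ]⊆⁅ p ⁆∪⁅ q ⁆

  narrow : N[ w ]⊆⁅ p ⁆∪⁅ q ⁆ → ¬ A w q → N[ w ]⊆⁅ p ⁆
  narrow N⊆ ¬wq u wu = [ id , (λ { refl → contradiction wu ¬wq }) ]′ (N⊆ u wu)

  blocker-cases : Blocked p q → Support p ⊎ Support q ⊎ ∃[ w ] (A w p × A w q × N[ w ]⊆⁅ p ⁆∪⁅ q ⁆)
  blocker-cases {p} {q} (w , N⊆) with A? w p | A? w q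
  ... | yes wp | yes wq = inj₂ (inj₂ (w , wp , wq , N⊆))
  ... | _      | no ¬wq = inj₁ (w , narrow N⊆ ¬wq)
  ... | no ¬wp | yes _  = inj₂ (inj₁ (w , narrow (λ u wu → ⊎-swap (N⊆ u wu)) ¬wp))

  -- {x, a, b} is a union of components; it is a P₃ or K₃ when x is adjacent to a and b.
  Closed : Fin V → Fin V → Fin V → Set
  Closed x a b = N[ x ]⊆⁅ a ⁆∪⁅ b ⁆ × N[ a ]⊆⁅ x ⁆∪⁅ b ⁆ × N[ b ]⊆⁅ x ⁆∪⁅ a ⁆

  Closed-nbr : Closed x a b → c ≡ x ⊎ c ≡ a ⊎ c ≡ b → A c v → v ≡ x ⊎ v ≡ a ⊎ v ≡ b
  Closed-nbr (Nx , _ , _) (inj₁ refl) cv = inj₂ (Nx _ cv)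
  Closed-nbr (_ , Na , _) (inj₂ (inj₁ refl)) cv = [ inj₁ , inj₂ ∘ inj₂ ]′ (Na _ cv)
  Closed-nbr (_ , _ , Nb) (inj₂ (inj₂ refl)) cv = [ inj₁ , inj₂ ∘ inj₁ ]′ (Nb _ cv)

  ¬TDS[∁⁅p⁆]⇒Support : ¬ IsTDS A (∁ ⁅ p ⁆) → Support p
  ¬TDS[∁⁅p⁆]⇒Support ¬tds with undominated ¬tds
  ... | w , ¬dom = w , λ u wu → x∉∁⁅y⁆⇒x≡y (¬dom u wu)

  ¬TDS[∁⁅p⁆-q]⇒Blocked : ¬ IsTDS A (∁ ⁅ p ⁆ - q) → Blocked p q
  ¬TDS[∁⁅p⁆-q]⇒Blocked ¬tds with undominated ¬tds
  ... | w , ¬dom = w , λ u wu → x∉∁⁅y⁆-z⇒x≡y⊎x≡z (¬dom u wu)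

  Support⇒∈TDS : {S : Subset V} → IsTDS A S → Support v → v ∈ S
  Support⇒∈TDS {S = S} tds (w , w-leaf) with tds w
  ... | u , u∈S , wu = subst (_∈ S) (w-leaf u wu) u∈S

  TDS-dominates : {S : Subset V} → IsTDS A S → N[ w ]⊆⁅ p ⁆∪⁅ q ⁆ → p ∉ S → q ∈ S
  TDS-dominates {w} tds N⊆ p∉S with tds w
  ... | u , u∈S , wu with N⊆ u wu
  ...   | inj₁ refl = contradiction u∈S p∉S
  ...   | inj₂ refl = u∈S

  Closed⇒TDS-misses-≤1 : {S : Subset V} → Closed x a b → IsTDS A S →
    ∃[ z ] (∀ {v} → v ≡ x ⊎ v ≡ a ⊎ v ≡ b → v ≢ z → v ∈ S)
  Closed⇒TDS-misses-≤1 {x} {a} {b} {S} (Nx , Na , Nb) tds with x ∈? S | a ∈? S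
  ... | no x∉S  | _       = x , λ { (inj₁ refl) v≢x → ⊥-elim (v≢x refl)
                                  ; (inj₂ (inj₁ refl)) _ → TDS-dominates tds Nb x∉S
                                  ; (inj₂ (inj₂ refl)) _ → TDS-dominates tds Na x∉S }
  ... | yes x∈S | no a∉S  = a , λ { (inj₁ refl) _ → x∈S
                                  ; (inj₂ (inj₁ refl)) v≢a → ⊥-elim (v≢a refl)
                                  ; (inj₂ (inj₂ refl)) _ → TDS-dominates tds Nx a∉S }
  ... | yes x∈S | yes a∈S = b , λ { (inj₁ refl) _ → x∈S
                                  ; (inj₂ (inj₁ refl)) _ → a∈S
                                  ; (inj₂ (inj₂ refl)) v≢b → ⊥-elim (v≢b refl) }

  Closed⇒V∸1≤∣TDS∣ : {S : Subset V} → Closed x a b → (∀ v → v ≢ x → v ≢ a → v ≢ b → Support v) →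
    IsTDS A S → V ∸ 1 ≤ ∣ S ∣
  Closed⇒V∸1≤∣TDS∣ {x} {a} {b} {S} cl supported tds with Closed⇒TDS-misses-≤1 cl tds
  ... | z , triple∈S = ∁⁅x⁆⊆p⇒n∸1≤∣p∣ λ {v} v∈ → in-S v (x∈∁⁅y⁆⇒x≢y v∈)
    where
    in-S : ∀ v → v ≢ z → v ∈ S
    in-S v v≢z with v ≟ x | v ≟ a | v ≟ b
    ... | yes v≡x | _       | _       = triple∈S (inj₁ v≡x) v≢z
    ... | no _    | yes v≡a | _       = triple∈S (inj₂ (inj₁ v≡a)) v≢z
    ... | no _    | no _    | yes v≡b = triple∈S (inj₂ (inj₂ v≡b)) v≢z
    ... | no v≢x  | no v≢a  | no v≢b  = Support⇒∈TDS tds (supported v v≢x v≢a v≢b)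

  module WithoutIsolated (no-isolated : NoIsolated A) where

    leaf-adj : N[ w ]⊆⁅ p ⁆ → A w p
    leaf-adj {w} w-leaf with no-isolated w
    ... | u , wu = subst (A w) (w-leaf u wu) wu

    leaf-of-leaf : N[ a ]⊆⁅ s ⁆ → N[ w ]⊆⁅ a ⁆ → N[ s ]⊆⁅ a ⁆
    leaf-of-leaf a-leaf w-leaf = subst N[_]⊆⁅ _ ⁆ (a-leaf _ (A-sym (leaf-adj w-leaf))) w-leaf

    unique-nbr⇒degree≤1 : (∀ {c d} → A v c → A v d → c ≡ d) → degree v ≤ 1
    unique-nbr⇒degree≤1 {v} unique with no-isolated v
    ... | c , vc = degree≤1 λ u vu → unique vu vc

    all-Support⇒∑degree≡V : (∀ p → Support p) → ∑[ v < V ] degree v ≡ V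
    all-Support⇒∑degree≡V supported = ≤-antisym
      (subst (∑[ v < V ] degree v ≤_) (sum-ones V) (sum-mono λ v → degree≤1 (proj₂ (leaf-partner v))))
      (subst (_≤ ∑[ v < V ] degree v) (sum-ones V) (sum-mono λ v → degree≥1 (proj₂ (no-isolated v))))
      where
      leaf-partner : ∀ v → ∃[ w ] N[ v ]⊆⁅ w ⁆
      leaf-partner v with supported v
      ... | w , w-leaf with supported w
      ...   | w′ , w′-leaf = w , leaf-of-leaf w-leaf w′-leaf

    -- This is the situation of a graph in which no TDS misses two vertices.
    module PairsBlocked (blocked : ∀ {p q} → p ≢ q → Blocked p q) where

      support-star : N[ p ]⊆⁅ s ⁆ → A s a → N[ a ]⊆⁅ s ⁆
      support-star {p} {s} {a} p-leaf sa t at with t ≟ s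
      ... | yes t≡s = t≡s
      ... | no t≢s = ⊥-elim impossible
        where
        -- A second neighbour t of a makes the pair {p, t}, and then {p, w} for a leaf w
        -- at t, unblockable.
        s-not-leaf : ¬ N[ s ]⊆⁅ p ⁆
        s-not-leaf s-leaf = t≢s (p-leaf t (subst (λ y → A y t) (s-leaf a sa) at))

        p-unsupported : ¬ Support p
        p-unsupported (w , w-leaf) = s-not-leaf (leaf-of-leaf p-leaf w-leaf)

        p≢t : p ≢ t
        p≢t refl = A-irrefl (subst (A s) (p-leaf a (A-sym at)) sa)

        p≢leaf-at-t : N[ w ]⊆⁅ t ⁆ → p ≢ w
        p≢leaf-at-t w-leaf refl = t≢s (sym (w-leaf s (leaf-adj p-leaf)))

        t-unsupported : ¬ Support t
        t-unsupported (w , w-leaf) with blocker-cases (blocked (p≢leaf-at-t w-leaf))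
        ... | inj₁ p-supported = p-unsupported p-supported
        ... | inj₂ (inj₁ (y , y-leaf)) =
          t≢s (sym (w-leaf s (subst (λ z → A z s) (leaf-of-leaf w-leaf y-leaf a (A-sym at)) (A-sym sa))))
        ... | inj₂ (inj₂ (y , yp , yw , _)) = t≢s (trans (sym (w-leaf y (A-sym yw))) (p-leaf y (A-sym yp)))

        impossible : ⊥
        impossible with blocker-cases (blocked p≢t)
        ... | inj₁ p-supported = p-unsupported p-supported
        ... | inj₂ (inj₁ t-supported) = t-unsupported t-supported
        ... | inj₂ (inj₂ (w , wp , wt , N⊆)) with p-leaf w (A-sym wp)
        ...   | refl with N⊆ a sa
        ...     | inj₁ refl = t≢s (p-leaf t at)
        ...     | inj₂ refl = A-irrefl at

      nbr-of-branch-unsupported : a ≢ b → A x a → A x b → A x y → ¬ Support y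
      nbr-of-branch-unsupported a≢b xa xb xy (w , w-leaf) = a≢b (trans (x-leaf _ xa) (sym (x-leaf _ xb)))
        where x-leaf = support-star w-leaf (A-sym xy)

      exact-blocker : p ≢ q → ¬ Support p → ¬ Support q → ∃[ w ] (A w p × A w q × N[ w ]⊆⁅ p ⁆∪⁅ q ⁆)
      exact-blocker p≢q ¬sp ¬sq with blocker-cases (blocked p≢q)
      ... | inj₁ sp = ⊥-elim (¬sp sp)
      ... | inj₂ (inj₁ sq) = ⊥-elim (¬sq sq)
      ... | inj₂ (inj₂ w) = w

      supported-branch⇒Closed : Support x → a ≢ b → A x a → A x b → Closed a x b × ¬ Support a
      supported-branch⇒Closed {x} {a} {b} (p , p-leaf) a≢b xa xb = (Na , Nx , Nb) , ¬sa
        where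
        a-leaf : N[ a ]⊆⁅ x ⁆
        a-leaf = support-star p-leaf xa
        ¬sa : ¬ Support a
        ¬sa = nbr-of-branch-unsupported a≢b xa xb xa
        Na : N[ a ]⊆⁅ x ⁆∪⁅ b ⁆
        Na u au = inj₁ (a-leaf u au)
        Nb : N[ b ]⊆⁅ a ⁆∪⁅ x ⁆
        Nb u bu = inj₂ (support-star p-leaf xb u bu)
        Nx : N[ x ]⊆⁅ a ⁆∪⁅ b ⁆
        Nx with exact-blocker a≢b ¬sa (nbr-of-branch-unsupported a≢b xa xb xb)
        ... | w , wa , _ , Nw = subst N[_]⊆⁅ a ⁆∪⁅ b ⁆ (a-leaf w (A-sym wa)) Nw

      third-vertex : A c p → N[ c ]⊆⁅ p ⁆∪⁅ q ⁆ → ¬ Support p → ¬ Support c → N[ q ]⊆⁅ p ⁆∪⁅ c ⁆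
      third-vertex cp Nc ¬sp ¬sc with exact-blocker (λ { refl → A-irrefl cp }) ¬sp ¬sc
      ... | w , wp , wc , Nw with Nc w (A-sym wc)
      ...   | inj₁ refl = ⊥-elim (A-irrefl wp)
      ...   | inj₂ refl = Nw

      unsupported-branch⇒Closed : ¬ Support x → a ≢ b → A x a → A x b → Closed x a b
      unsupported-branch⇒Closed {x} {a} {b} ¬sx a≢b xa xb = triangle (exact-blocker x≢a ¬sx ¬sa)
        where
        x≢a : x ≢ a
        x≢a refl = A-irrefl xa
        ¬sa : ¬ Support a
        ¬sa = nbr-of-branch-unsupported a≢b xa xb xa
        triangle : ∃[ c ] (A c x × A c a × N[ c ]⊆⁅ x ⁆∪⁅ a ⁆) → Closed x a b
        triangle (c , cx , ca , Nc) = [ (λ b≡a → ⊥-elim (a≢b (sym b≡a))) , closed ]′ (Nx b xb)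
          where
          ¬sc : ¬ Support c
          ¬sc = nbr-of-branch-unsupported a≢b xa xb (A-sym cx)
          Nx : N[ x ]⊆⁅ a ⁆∪⁅ c ⁆
          Nx = third-vertex ca (λ u cu → ⊎-swap (Nc u cu)) ¬sa ¬sc
          closed : b ≡ c → Closed x a b
          closed b≡c = subst (Closed x a) (sym b≡c) (Nx , third-vertex cx Nc ¬sx ¬sc , Nc)

      outside-Closed-no-branch : Closed x a b → ¬ Support x → ¬ (v ≡ x ⊎ v ≡ a ⊎ v ≡ b) →
        c ≢ d → A v c → A v d → ⊥
      outside-Closed-no-branch {x} {a} {b} {v} {c} {d} cl ¬sx v-out c≢d vc vd =
        cases (blocker-cases (blocked x≢c))
        where
        c-out : ¬ (c ≡ x ⊎ c ≡ a ⊎ c ≡ b)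
        c-out c∈ = v-out (Closed-nbr cl c∈ (A-sym vc))
        x≢c : x ≢ c
        x≢c x≡c = c-out (inj₁ (sym x≡c))
        cases : Support x ⊎ Support c ⊎ ∃[ w ] (A w x × A w c × N[ w ]⊆⁅ x ⁆∪⁅ c ⁆) → ⊥
        cases (inj₁ sx) = ¬sx sx
        cases (inj₂ (inj₁ (w , w-leaf))) = c≢d (sym (support-star w-leaf (A-sym vc) d vd))
        cases (inj₂ (inj₂ (w , wx , wc , _))) = c-out (Closed-nbr cl (inj₂ (proj₁ cl w (A-sym wx))) wc)

      Closed⇒∑degree≤V+3 : Closed x a b × ¬ Support x → ∑[ v < V ] degree v ≤ V + 3
      Closed⇒∑degree≤V+3 {x} {a} {b} (cl@(Nx , Na , Nb) , ¬sx) = begin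
        ∑[ v < V ] degree v                                    ≤⟨ sum-mono bound ⟩
        ∑[ v < V ] (1 + 𝟙 (v ≟ x) + 𝟙 (v ≟ a) + 𝟙 (v ≟ b))   ≡⟨ ∑[1+𝟙+𝟙+𝟙]≡n+3 x a b ⟩
        V + 3                                                  ∎
        where
        open ≤-Reasoning
        bound : ∀ v → degree v ≤ 1 + 𝟙 (v ≟ x) + 𝟙 (v ≟ a) + 𝟙 (v ≟ b)
        bound v with v ≟ x | v ≟ a | v ≟ b
        ... | yes refl | v≟a | v≟b = ≤-trans (degree≤2 Nx) (≤-trans (m≤m+n 2 (𝟙 v≟a)) (m≤m+n (2 + 𝟙 v≟a) (𝟙 v≟b)))
        ... | no _ | yes refl | v≟b = ≤-trans (degree≤2 Na) (m≤m+n 2 (𝟙 v≟b))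
        ... | no _ | no _ | yes refl = degree≤2 Nb
        ... | no v≢x | no v≢a | no v≢b = unique-nbr⇒degree≤1 λ {c} {d} vc vd →
          decidable-stable (c ≟ d) λ c≢d → outside-Closed-no-branch cl ¬sx [ v≢x , [ v≢a , v≢b ]′ ]′ c≢d vc vd

      ∑degree≤V+3 : ∑[ v < V ] degree v ≤ V + 3
      ∑degree≤V+3 with any? (λ x → any? λ a → any? λ b → ¬? (a ≟ b) ×-dec A? x a ×-dec A? x b)
      ... | yes (x , a , b , a≢b , xa , xb) with Support? x
      ...   | yes sx = Closed⇒∑degree≤V+3 (supported-branch⇒Closed sx a≢b xa xb)
      ...   | no ¬sx = Closed⇒∑degree≤V+3 (unsupported-branch⇒Closed ¬sx a≢b xa xb , ¬sx)
      ∑degree≤V+3 | no ¬branch = begin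
        ∑[ v < V ] degree v   ≤⟨ sum-mono (λ v → unique-nbr⇒degree≤1 (unique v)) ⟩
        ∑[ v < V ] 1          ≡⟨ sum-ones V ⟩
        V                     ≤⟨ m≤m+n V 3 ⟩
        V + 3                 ∎
        where
        open ≤-Reasoning
        unique : ∀ v {c d} → A v c → A v d → c ≡ d
        unique v {c} {d} vc vd = decidable-stable (c ≟ d) λ c≢d → ¬branch (v , c , d , c≢d , vc , vd)

module EdgeList {V E : ℕ} (ends : Fin E → Fin V × Fin V) where

  private variable u v : Fin V

  _≟²_ : (p q : Fin V × Fin V) → Dec (p ≡ q)
  _≟²_ = ≡-dec _≟_ _≟_

  Joins : Fin E → Fin V → Fin V → Set
  Joins e u v = ends e ≡ (u , v) ⊎ ends e ≡ (v , u)

  joins? : ∀ e u v → Dec (Joins e u v)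
  joins? e u v = (ends e ≟² (u , v)) ⊎-dec (ends e ≟² (v , u))

  Loopless : Set
  Loopless = ∀ e → proj₁ (ends e) ≢ proj₂ (ends e)

  Simple : Set
  Simple = ∀ {e e′ u v} → Joins e u v → Joins e′ u v → e ≡ e′

  ∑∑𝟙[p≡v,u]≡1 : (p : Fin V × Fin V) → ∑[ v < V ] ∑[ u < V ] 𝟙 (p ≟² (v , u)) ≡ 1
  ∑∑𝟙[p≡v,u]≡1 p@(a , b) = begin
    ∑[ v < V ] ∑[ u < V ] 𝟙 (p ≟² (v , u))   ≡⟨ sum-cong-≗ row ⟩
    ∑[ v < V ] 𝟙 (v ≟ a)                     ≡⟨ sum-𝟙-≟ a ⟩
    1                                        ∎
    where
    open ≡-Reasoning
    row : ∀ v → ∑[ u < V ] 𝟙 (p ≟² (v , u)) ≡ 𝟙 (v ≟ a)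
    row v = trans (sum-𝟙-unique (λ u → p ≟² (v , u)) (λ { refl refl → refl }))
                  (𝟙-cong (λ { (_ , refl) → refl }) (λ { refl → b , refl }) (any? λ u → p ≟² (v , u)) (v ≟ a))

  ∑∑𝟙-Joins≡2 : Loopless → ∀ e → ∑[ v < V ] ∑[ u < V ] 𝟙 (joins? e v u) ≡ 2
  ∑∑𝟙-Joins≡2 loopless e = begin
    ∑[ v < V ] ∑[ u < V ] 𝟙 (joins? e v u)
      ≡⟨ sum-cong-≗ (λ v → sum-cong-≗ λ u → 𝟙-⊎ (not-both v u) (ends e ≟² (v , u)) (ends e ≟² (u , v))) ⟩
    ∑[ v < V ] ∑[ u < V ] (𝟙 (ends e ≟² (v , u)) + 𝟙 (ends e ≟² (u , v)))
      ≡⟨ sum-cong-≗ (λ v → ∑-distrib-+ (λ u → 𝟙 (ends e ≟² (v , u))) (λ u → 𝟙 (ends e ≟² (u , v)))) ⟩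
    ∑[ v < V ] (∑[ u < V ] 𝟙 (ends e ≟² (v , u)) + ∑[ u < V ] 𝟙 (ends e ≟² (u , v)))
      ≡⟨ ∑-distrib-+ (λ v → ∑[ u < V ] 𝟙 (ends e ≟² (v , u))) (λ v → ∑[ u < V ] 𝟙 (ends e ≟² (u , v))) ⟩
    ∑[ v < V ] ∑[ u < V ] 𝟙 (ends e ≟² (v , u)) + ∑[ v < V ] ∑[ u < V ] 𝟙 (ends e ≟² (u , v))
      ≡⟨ cong (∑[ v < V ] ∑[ u < V ] 𝟙 (ends e ≟² (v , u)) +_) (∑-comm (λ v u → 𝟙 (ends e ≟² (u , v)))) ⟩
    ∑[ v < V ] ∑[ u < V ] 𝟙 (ends e ≟² (v , u)) + ∑[ u < V ] ∑[ v < V ] 𝟙 (ends e ≟² (u , v))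
      ≡⟨ cong₂ _+_ (∑∑𝟙[p≡v,u]≡1 (ends e)) (∑∑𝟙[p≡v,u]≡1 (ends e)) ⟩
    2 ∎
    where
    open ≡-Reasoning
    not-both : ∀ v u → ¬ (ends e ≡ (v , u) × ends e ≡ (u , v))
    not-both v u (p , q) = loopless e (trans (cong proj₁ p) (cong proj₂ (sym q)))

  module _ (D : Subset E) where

    Adj : Adjacency V
    Adj u v = ∃[ e ] (e ∉ D × Joins e u v)

    Adj-sym : Adj u v → Adj v u
    Adj-sym (e , e∉D , joins) = e , e∉D , ⊎-swap joins

    Adj-irrefl : Loopless → ¬ Adj u u
    Adj-irrefl loopless (e , _ , inj₁ eq) = loopless e (trans (cong proj₁ eq) (sym (cong proj₂ eq)))
    Adj-irrefl loopless (e , _ , inj₂ eq) = loopless e (trans (cong proj₁ eq) (sym (cong proj₂ eq)))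

    kept-joins? : ∀ u v e → Dec (e ∉ D × Joins e u v)
    kept-joins? u v e = ¬? (e ∈? D) ×-dec joins? e u v

    Adj? : ∀ u v → Dec (Adj u v)
    Adj? u v = any? (kept-joins? u v)

    handshake : Loopless → Simple → ∑[ v < V ] ∑[ u < V ] 𝟙 (Adj? v u) ≡ 2 * ∣ ∁ D ∣
    handshake loopless simple = begin
      ∑[ v < V ] ∑[ u < V ] 𝟙 (Adj? v u)
        ≡⟨ sum-cong-≗ (λ v → sum-cong-≗ λ u → sum-𝟙-unique (kept-joins? v u) (λ (_ , j) (_ , j′) → simple j j′)) ⟨
      ∑[ v < V ] ∑[ u < V ] ∑[ e < E ] 𝟙 (kept-joins? v u e)
        ≡⟨ sum-cong-≗ (λ v → ∑-comm (λ u e → 𝟙 (kept-joins? v u e))) ⟩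
      ∑[ v < V ] ∑[ e < E ] ∑[ u < V ] 𝟙 (kept-joins? v u e)
        ≡⟨ ∑-comm (λ v e → ∑[ u < V ] 𝟙 (kept-joins? v u e)) ⟩
      ∑[ e < E ] ∑[ v < V ] ∑[ u < V ] 𝟙 (kept-joins? v u e)
        ≡⟨ sum-cong-≗ edge ⟩
      ∑[ e < E ] (2 * 𝟙 (¬? (e ∈? D)))
        ≡⟨ *-distribˡ-sum 2 (λ e → 𝟙 (¬? (e ∈? D))) ⟨
      2 * ∑[ e < E ] 𝟙 (¬? (e ∈? D))
        ≡⟨ cong (2 *_) (sum-cong-≗ λ e → 𝟙-cong x∉p⇒x∈∁p x∈∁p⇒x∉p (¬? (e ∈? D)) (e ∈? ∁ D)) ⟩
      2 * ∑[ e < E ] 𝟙 (e ∈? ∁ D)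
        ≡⟨ cong (2 *_) (∣p∣≡∑𝟙∈ (∁ D)) ⟨
      2 * ∣ ∁ D ∣ ∎
      where
      open ≡-Reasoning
      edge : ∀ e → ∑[ v < V ] ∑[ u < V ] 𝟙 (kept-joins? v u e) ≡ 2 * 𝟙 (¬? (e ∈? D))
      edge e with e ∈? D
      ... | yes _ = sum-zero {V} λ v → sum-zero {V} λ u → refl
      ... | no _ = ∑∑𝟙-Joins≡2 loopless e

  module Keeping {R : Fin V × Fin V → Set} (R? : ∀ p → Dec (R p)) where

    deletion : Subset E
    deletion = tabulate λ e → not (does (R? (ends e)))

    kept⇒R : ∀ {e} → e ∉ deletion → R (ends e)
    kept⇒R {e} e∉ = decidable-stable (R? (ends e)) λ ¬r →
      e∉ (lookup⇒[]= e deletion (trans (lookup∘tabulate _ e) (cong not (dec-false (R? (ends e)) ¬r))))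

    R⇒kept : ∀ {e} → R (ends e) → e ∉ deletion
    R⇒kept {e} r e∈ with trans (sym ([]=⇒lookup e∈)) (trans (lookup∘tabulate _ e) (cong not (dec-true (R? (ends e)) r)))
    ... | ()

    Adj⇒R : Adj deletion u v → R (u , v) ⊎ R (v , u)
    Adj⇒R (e , e∉ , inj₁ eq) = inj₁ (subst R eq (kept⇒R e∉))
    Adj⇒R (e , e∉ , inj₂ eq) = inj₂ (subst R eq (kept⇒R e∉))

    R⇒Adj : ∃[ e ] ends e ≡ (u , v) → R (u , v) → Adj deletion u v
    R⇒Adj (e , eq) r = e , R⇒kept (subst R (sym eq) r) , inj₁ eq

toℕ-next : {n : ℕ} (i : Fin n) → toℕ (next i) ≡ suc (toℕ i) ⊎ (toℕ (next i) ≡ 0 × suc (toℕ i) ≡ n)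
toℕ-next {suc m} i with suc (toℕ i) <? suc m
... | yes i+1<n = inj₁ (toℕ-fromℕ< i+1<n)
... | no i+1≮n = inj₂ (refl , ≤-antisym (toℕ<n i) (≮⇒≥ i+1≮n))

next≢id : {n : ℕ} → 2 ≤ n → (i : Fin n) → next i ≢ i
next≢id 2≤n i eq with toℕ-next i
... | inj₁ next≡ = 1+n≢n (trans (sym next≡) (cong toℕ eq))
... | inj₂ (next≡0 , i+1≡n) = <⇒≢ 2≤n (trans (cong suc (sym (trans (sym (cong toℕ eq)) next≡0))) i+1≡n)

next²≢id : {n : ℕ} → 3 ≤ n → (i : Fin n) → next (next i) ≢ i
next²≢id {n} 3≤n i eq with toℕ-next i | toℕ-next (next i)
... | inj₁ j≡ | inj₁ k≡ = <⇒≢ (m<n⇒m<1+n (n<1+n _)) (trans (sym (cong toℕ eq)) (trans k≡ (cong suc j≡)))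
... | inj₁ j≡ | inj₂ (k≡0 , j+1≡n) =
  <⇒≢ 3≤n (trans (cong suc (sym (trans j≡ (cong suc (trans (sym (cong toℕ eq)) k≡0))))) j+1≡n)
... | inj₂ (j≡0 , i+1≡n) | inj₁ k≡ =
  <⇒≢ 3≤n (trans (cong suc (sym (trans (sym (cong toℕ eq)) (trans k≡ (cong suc j≡0))))) i+1≡n)
... | inj₂ (j≡0 , _) | inj₂ (_ , j+1≡n) = <⇒≢ (≤-trans (s≤s (s≤s z≤n)) 3≤n) (trans (cong suc (sym j≡0)) j+1≡n)

edge-ends : (n : ℕ) → Fin n ⊎ Fin n → Fin (suc n) × Fin (suc n)
edge-ends n (inj₁ i) = zero , suc i
edge-ends n (inj₂ i) = suc i , suc (next i)

ends≡edge-ends : (n : ℕ) (e : Fin (n + n)) → ends n e ≡ edge-ends n (splitAt n e)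
ends≡edge-ends n e with splitAt n e
... | inj₁ i = refl
... | inj₂ i = refl

edge-ends-injective : {n : ℕ} {x y : Fin n ⊎ Fin n} → edge-ends n x ≡ edge-ends n y → x ≡ y
edge-ends-injective {x = inj₁ i} {inj₁ j} refl = refl
edge-ends-injective {x = inj₂ i} {inj₂ j} eq = cong inj₂ (Fin-suc-injective (,-injectiveˡ eq))
edge-ends-injective {x = inj₁ i} {inj₂ j} ()
edge-ends-injective {x = inj₂ i} {inj₁ j} ()

edge-ends-not-reversed : {n : ℕ} → 3 ≤ n → (x y : Fin n ⊎ Fin n) → edge-ends n x ≢ swap (edge-ends n y)
edge-ends-not-reversed 3≤n (inj₁ i) (inj₁ j) ()
edge-ends-not-reversed 3≤n (inj₁ i) (inj₂ j) ()
edge-ends-not-reversed 3≤n (inj₂ i) (inj₁ j) ()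
edge-ends-not-reversed 3≤n (inj₂ i) (inj₂ j) eq =
  next²≢id 3≤n j (trans (cong next (sym (Fin-suc-injective (,-injectiveˡ eq)))) (Fin-suc-injective (,-injectiveʳ eq)))

module WheelEdges (n : ℕ) where

  open EdgeList (ends n) public

  ends-injective : ∀ {e e′} → ends n e ≡ ends n e′ → e ≡ e′
  ends-injective {e} {e′} eq = begin
    e                          ≡⟨ join-splitAt n n e ⟨
    join n n (splitAt n e)     ≡⟨ cong (join n n) (edge-ends-injective (begin
      edge-ends n (splitAt n e)   ≡⟨ ends≡edge-ends n e ⟨
      ends n e                    ≡⟨ eq ⟩
      ends n e′                   ≡⟨ ends≡edge-ends n e′ ⟩
      edge-ends n (splitAt n e′)  ∎)) ⟩
    join n n (splitAt n e′)    ≡⟨ join-splitAt n n e′ ⟩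
    e′                         ∎
    where open ≡-Reasoning

  loopless : 2 ≤ n → Loopless
  loopless 2≤n e with splitAt n e
  ... | inj₁ i = λ ()
  ... | inj₂ i = λ eq → next≢id 2≤n i (sym (Fin-suc-injective eq))

  ends-not-reversed : 3 ≤ n → ∀ e e′ → ends n e ≢ swap (ends n e′)
  ends-not-reversed 3≤n e e′ eq = edge-ends-not-reversed 3≤n (splitAt n e) (splitAt n e′)
    (trans (sym (ends≡edge-ends n e)) (trans eq (cong swap (ends≡edge-ends n e′))))

  simple : 3 ≤ n → Simple
  simple 3≤n (inj₁ p) (inj₁ q) = ends-injective (trans p (sym q))
  simple 3≤n (inj₂ p) (inj₂ q) = ends-injective (trans p (sym q))
  simple 3≤n {e} {e′} (inj₁ p) (inj₂ q) = ⊥-elim (ends-not-reversed 3≤n e e′ (trans p (sym (cong swap q))))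
  simple 3≤n {e} {e′} (inj₂ p) (inj₁ q) = ⊥-elim (ends-not-reversed 3≤n e e′ (trans p (sym (cong swap q))))

  spoke : Fin n → Fin (n + n)
  spoke i = i ↑ˡ n

  rim : Fin n → Fin (n + n)
  rim i = n ↑ʳ i

  spoke-ends : (i : Fin n) → ends n (spoke i) ≡ (zero , suc i)
  spoke-ends i = trans (ends≡edge-ends n (spoke i)) (cong (edge-ends n) (splitAt-↑ˡ n i n))

  rim-ends : (i : Fin n) → ends n (rim i) ≡ (suc i , suc (next i))
  rim-ends i = trans (ends≡edge-ends n (rim i)) (cong (edge-ends n) (splitAt-↑ʳ n n i))

  consecutive-edge : (u v : Fin (suc n)) → toℕ v ≡ suc (toℕ u) → ∃[ e ] ends n e ≡ (u , v)
  consecutive-edge zero (suc j) _ = spoke j , spoke-ends j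
  consecutive-edge (suc i) (suc j) j≡i+1 = rim i , trans (rim-ends i) (cong (λ k → suc i , suc k) next≡j)
    where
    next≡j : next i ≡ j
    next≡j with toℕ-next i
    ... | inj₁ next≡ = toℕ-injective (trans next≡ (sym (suc-injective j≡i+1)))
    ... | inj₂ (_ , i+1≡n) = contradiction (trans (suc-injective j≡i+1) i+1≡n) (<⇒≢ (toℕ<n j))

module WheelBondage (m : ℕ) where

  n : ℕ
  n = 3 + m

  3≤n : 3 ≤ n
  3≤n = s≤s (s≤s (s≤s z≤n))

  open WheelEdges n

  module W (D : Subset (n + n)) = Graph (Adj-sym D) (Adj-irrefl D (loopless (s≤s (s≤s z≤n)))) (Adj? D)

  private variable
    D : Subset (n + n)
    S : Subset (suc n)

  ∑degree≡2*kept : (D : Subset (n + n)) → ∑[ v < suc n ] W.degree D v ≡ 2 * ∣ ∁ D ∣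
  ∑degree≡2*kept D = handshake D (loopless (s≤s (s≤s z≤n))) (simple 3≤n)

  2*n≡n+n : 2 * n ≡ n + n
  2*n≡n+n = cong (n +_) (+-identityʳ n)

  ∣∁D∣≡2*n∸∣D∣ : (D : Subset (n + n)) → ∣ ∁ D ∣ ≡ 2 * n ∸ ∣ D ∣
  ∣∁D∣≡2*n∸∣D∣ D = trans (∣∁p∣≡n∸∣p∣ D) (cong (_∸ ∣ D ∣) (sym 2*n≡n+n))

  ∣D∣≤2*n : (D : Subset (n + n)) → ∣ D ∣ ≤ 2 * n
  ∣D∣≤2*n D = subst (∣ D ∣ ≤_) (sym 2*n≡n+n) (∣p∣≤n D)

  deleted≥ : (D : Subset (n + n)) {M : ℕ} → 2 * ∣ ∁ D ∣ ≤ M → 2 * n ∸ M / 2 ≤ ∣ D ∣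
  deleted≥ D {M} le = halving-lower (∣D∣≤2*n D) (subst (λ c → 2 * c ≤ M) (∣∁D∣≡2*n∸∣D∣ D) le)

  deleted≤ : (D : Subset (n + n)) {M : ℕ} → M ≤ 2 * ∣ ∁ D ∣ → ∣ D ∣ ≤ 2 * n ∸ M / 2
  deleted≤ D {M} le = halving-upper (∣D∣≤2*n D) (subst (λ c → M ≤ 2 * c) (∣∁D∣≡2*n∸∣D∣ D) le)

  hub-rim₀ : Subset (suc n)
  hub-rim₀ = true ∷ true ∷ ∅

  hub-rim₀-TDS : IsTDS (Wheel n) hub-rim₀
  hub-rim₀-TDS zero = suc zero , there here , spoke zero , ∉⊥ , inj₁ (spoke-ends zero)
  hub-rim₀-TDS (suc i) = zero , here , spoke i , ∉⊥ , inj₂ (spoke-ends i)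

  ∣hub-rim₀∣≡2 : ∣ hub-rim₀ ∣ ≡ 2
  ∣hub-rim₀∣≡2 = cong (2 +_) (∣⊥∣≡0 (suc m))

  γt[Wheel]≡2 : IsGammaT (Wheel n) 2
  γt[Wheel]≡2 = (hub-rim₀ , hub-rim₀-TDS , ∣hub-rim₀∣≡2) , λ S → W.2≤∣TDS∣ ∅ zero

  γt[Wheel]-unique : {g : ℕ} → IsGammaT (Wheel n) g → g ≡ 2
  γt[Wheel]-unique ((S , tds , refl) , minimal) =
    ≤-antisym (subst (∣ S ∣ ≤_) ∣hub-rim₀∣≡2 (minimal hub-rim₀ hub-rim₀-TDS)) (W.2≤∣TDS∣ ∅ zero tds)

  good-deletion-TDS : {k : ℕ} → GoodDeletion n k D → IsTDS (WheelMinus n D) S → 2 + k ≤ ∣ S ∣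
  good-deletion-TDS {S = S} (_ , bound) tds = bound 2 γt[Wheel]≡2 S tds

  good-deletion[n∸1]⇒∣D∣≥ : (D : Subset (n + n)) → GoodDeletion n (n ∸ 1) D → 2 * n ∸ (n + 1) / 2 ≤ ∣ D ∣
  good-deletion[n∸1]⇒∣D∣≥ D good = deleted≥ D (≤-reflexive (begin
    2 * ∣ ∁ D ∣                 ≡⟨ ∑degree≡2*kept D ⟨
    ∑[ v < suc n ] degree v     ≡⟨ all-Support⇒∑degree≡V supported ⟩
    suc n                       ≡⟨ +-comm 1 n ⟩
    n + 1                       ∎))
    where
    open W D
    open WithoutIsolated (proj₁ good)
    open ≡-Reasoning
    supported : ∀ p → Support p
    supported p = ¬TDS[∁⁅p⁆]⇒Support λ tds → 1+n≰n (subst (suc n ≤_) (∣∁⁅x⁆∣≡n∸1 p) (good-deletion-TDS good tds))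

  good-deletion[n∸2]⇒∣D∣≥ : (D : Subset (n + n)) → GoodDeletion n (n ∸ 2) D → 2 * n ∸ (n + 4) / 2 ≤ ∣ D ∣
  good-deletion[n∸2]⇒∣D∣≥ D good = deleted≥ D (begin
    2 * ∣ ∁ D ∣                 ≡⟨ ∑degree≡2*kept D ⟨
    ∑[ v < suc n ] degree v     ≤⟨ ∑degree≤V+3 ⟩
    suc n + 3                   ≡⟨ +-suc n 3 ⟨
    n + 4                       ∎)
    where
    open W D
    open WithoutIsolated (proj₁ good)
    blocked : ∀ {p q} → p ≢ q → Blocked p q
    blocked {p} {q} p≢q = ¬TDS[∁⁅p⁆-q]⇒Blocked λ tds →
      <-irrefl refl (≤-<-trans (good-deletion-TDS good tds) (∣∁⁅x⁆-y∣<n∸1 (p≢q ∘ sym)))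
    open PairsBlocked blocked
    open ≤-Reasoning

  increase≤n∸1 : IncreaseAtMost n (n ∸ 1)
  increase≤n∸1 D no-isolated g γt rewrite γt[Wheel]-unique γt =
    ⊤ , (λ v → proj₁ (no-isolated v) , ∈⊤ , proj₂ (no-isolated v)) , ≤-reflexive (∣⊤∣≡n (suc n))

  increase≤n∸2 : 2 ∣ n → IncreaseAtMost n (n ∸ 2)
  increase≤n∸2 2∣n D no-isolated g γt rewrite γt[Wheel]-unique γt with any? (λ p → W.IsTDS? D (∁ ⁅ p ⁆))
  ... | yes (p , tds) = ∁ ⁅ p ⁆ , tds , ≤-reflexive (∣∁⁅x⁆∣≡n∸1 p)
  ... | no ¬tds = ⊥-elim (2∣n⇒2*k≢1+n 2∣n ∣ ∁ D ∣ (trans (sym (∑degree≡2*kept D)) (all-Support⇒∑degree≡V supported)))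
    where
    open W D
    open WithoutIsolated no-isolated
    supported : ∀ p → Support p
    supported p = ¬TDS[∁⁅p⁆]⇒Support λ tds → ¬tds (p , tds)

  -- The extremal graphs are described on vertex labels (hub 0, rim vertex i labelled
  -- i + 1): for odd n the matching {0,1}, {2,3}, …, for even n the triangle {0,1,2}
  -- and the matching {3,4}, {5,6}, ….
  Matched : Parity → Fin (suc n) × Fin (suc n) → Set
  Matched π (a , b) = toℕ b ≡ suc (toℕ a) × parity (toℕ a) ≡ π

  Matched? : ∀ π p → Dec (Matched π p)
  Matched? π (a , b) = (toℕ b ℕ.≟ suc (toℕ a)) ×-dec (parity (toℕ a) ≟ℙ π)

  Partners : Parity → Fin (suc n) → Fin (suc n) → Set
  Partners π v w = Matched π (v , w) ⊎ Matched π (w , v)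

  private variable
    π : Parity
    u v w : Fin (suc n)

  partners-unique : Partners π w u → Partners π w v → u ≡ v
  partners-unique (inj₁ (u≡ , _)) (inj₁ (v≡ , _)) = toℕ-injective (trans u≡ (sym v≡))
  partners-unique (inj₂ (w≡ , _)) (inj₂ (w≡′ , _)) = toℕ-injective (suc-injective (trans (sym w≡) w≡′))
  partners-unique (inj₁ (_ , pw)) (inj₂ (w≡ , pv)) = ⊥-elim (parity-alternates w≡ pv pw)
  partners-unique (inj₂ (w≡ , pu)) (inj₁ (_ , pw)) = ⊥-elim (parity-alternates w≡ pu pw)

  matched-edge : Matched π (u , v) → ∃[ e ] ends n e ≡ (u , v)
  matched-edge {u = u} {v} (v≡u+1 , _) = consecutive-edge u v v≡u+1

  -- Label k is matched upwards if parity k ≡ π and downwards otherwise; the hypotheses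
  -- keep both directions inside 0 … n.
  matched-partner : parity n ≢ π → (v : Fin (suc n)) → π ≡ 0ℙ ⊎ v ≢ zero → ∃[ w ] Partners π v w
  matched-partner {π} n≢π v hub-ok with parity (toℕ v) ≟ℙ π
  ... | yes pv≡π = fromℕ< v+1<1+n , inj₁ (toℕ-fromℕ< v+1<1+n , pv≡π)
    where
    v+1<1+n : suc (toℕ v) < suc n
    v+1<1+n = s≤s (≤∧≢⇒< (≤-pred (toℕ<n v)) λ v≡n → n≢π (subst (λ k → parity k ≡ π) v≡n pv≡π))
  ... | no pv≢π = predecessor v hub-ok pv≢π
    where
    predecessor : ∀ v → π ≡ 0ℙ ⊎ v ≢ zero → parity (toℕ v) ≢ π → ∃[ w ] Partners π v w
    predecessor zero (inj₁ π≡0ℙ) p0≢π = ⊥-elim (p0≢π (sym π≡0ℙ))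
    predecessor zero (inj₂ 0≢0) _ = ⊥-elim (0≢0 refl)
    predecessor (suc j) _ pv≢π = inject₁ j , inj₂ (cong suc (sym (toℕ-inject₁ j)) ,
      subst (λ k → parity k ≡ π) (sym (toℕ-inject₁ j)) (trans (sym (suc-homo-⁻¹ (toℕ j))) (p≢q⇒p⁻¹≡q pv≢π)))

  module WheelKeeping {R : Fin (suc n) × Fin (suc n) → Set} (R? : ∀ p → Dec (R p)) where

    open Keeping R? public
    open W deletion public

    matched-adj : (∀ {p} → Matched π p → R p) → Partners π v w → Adj deletion v w
    matched-adj Matched⊆R (inj₁ vw) = R⇒Adj (matched-edge vw) (Matched⊆R vw)
    matched-adj Matched⊆R (inj₂ wv) = Adj-sym deletion (R⇒Adj (matched-edge wv) (Matched⊆R wv))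

    matched-leaf : (∀ {u} → R (w , u) ⊎ R (u , w) → Partners π w u) → Partners π v w → N[ w ]⊆⁅ v ⁆
    matched-leaf only-matched vw u wu = partners-unique (only-matched (Adj⇒R wu)) (⊎-swap vw)

  module PerfectMatching (n-odd : parity n ≢ 0ℙ) where

    open WheelKeeping (Matched? 0ℙ) public

    leaf-partner : ∀ v → ∃[ w ] (Adj deletion v w × N[ w ]⊆⁅ v ⁆)
    leaf-partner v with matched-partner n-odd v (inj₁ refl)
    ... | w , vw = w , matched-adj id vw , matched-leaf id vw

    no-isolated : NoIsolated (WheelMinus n deletion)
    no-isolated v = proj₁ (leaf-partner v) , proj₁ (proj₂ (leaf-partner v))

    good : GoodDeletion n (n ∸ 1) deletion
    good = no-isolated , λ g γt S tds → subst (λ g → g + (n ∸ 1) ≤ ∣ S ∣) (sym (γt[Wheel]-unique γt))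
      (⊤⊆p⇒n≤∣p∣ λ {v} _ → Support⇒∈TDS tds (proj₁ (leaf-partner v) , proj₂ (proj₂ (leaf-partner v))))

    deleted≤bound : ∣ deletion ∣ ≤ 2 * n ∸ (n + 1) / 2
    deleted≤bound = deleted≤ deletion (begin
      n + 1                          ≡⟨ +-comm n 1 ⟩
      suc n                          ≡⟨ sum-ones (suc n) ⟨
      ∑[ v < suc n ] 1               ≤⟨ sum-mono (λ v → degree≥1 (proj₂ (no-isolated v))) ⟩
      ∑[ v < suc n ] degree v        ≡⟨ ∑degree≡2*kept deletion ⟩
      2 * ∣ ∁ deletion ∣             ∎)
      where open ≤-Reasoning

  bondage[n∸1] : parity n ≢ 0ℙ → IsBondageT n (n ∸ 1) (2 * n ∸ (n + 1) / 2)
  bondage[n∸1] n-odd =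
    (deletion , good , ≤-antisym deleted≤bound (good-deletion[n∸1]⇒∣D∣≥ deletion good)) , good-deletion[n∸1]⇒∣D∣≥
    where open PerfectMatching n-odd

  HubSpoke : Fin (suc n) × Fin (suc n) → Set
  HubSpoke (a , b) = toℕ a ≡ 0 × toℕ b ≤ 2

  TriangleMatching : Fin (suc n) × Fin (suc n) → Set
  TriangleMatching p = Matched 1ℙ p ⊎ HubSpoke p

  TriangleMatching? : ∀ p → Dec (TriangleMatching p)
  TriangleMatching? p@(a , b) = Matched? 1ℙ p ⊎-dec ((toℕ a ℕ.≟ 0) ×-dec (toℕ b ℕ.≤? 2))

  partner-of-outer : 3 ≤ toℕ v → Partners 1ℙ v w → 3 ≤ toℕ w
  partner-of-outer 3≤v (inj₁ (w≡v+1 , _)) = ≤-trans 3≤v (subst (toℕ _ ≤_) (sym w≡v+1) (n≤1+n _))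
  partner-of-outer 3≤v (inj₂ (v≡w+1 , pw≡1ℙ)) =
    ≤∧≢⇒< (≤-pred (subst (3 ≤_) v≡w+1 3≤v)) λ 2≡w → parity-alternates {1} (sym 2≡w) refl pw≡1ℙ

  module TriangleAndMatching (n-even : parity n ≡ 0ℙ) where

    open WheelKeeping TriangleMatching? public

    h r₁ r₂ : Fin (suc n)
    h = zero
    r₁ = suc zero
    r₂ = suc (suc zero)

    irrefl : ¬ Adj deletion u u
    irrefl = Adj-irrefl deletion (loopless (s≤s (s≤s z≤n)))

    h-r₁ : Adj deletion h r₁
    h-r₁ = R⇒Adj (consecutive-edge h r₁ refl) (inj₂ (refl , s≤s z≤n))

    h-r₂ : Adj deletion h r₂
    h-r₂ = R⇒Adj (spoke (suc zero) , spoke-ends (suc zero)) (inj₂ (refl , s≤s (s≤s z≤n)))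

    r₁-r₂ : Adj deletion r₁ r₂
    r₁-r₂ = R⇒Adj (consecutive-edge r₁ r₂ refl) (inj₁ (refl , refl))

    N[h] : N[ h ]⊆⁅ r₁ ⁆∪⁅ r₂ ⁆
    N[h] zero hh = ⊥-elim (irrefl hh)
    N[h] (suc zero) _ = inj₁ refl
    N[h] (suc (suc zero)) _ = inj₂ refl
    N[h] (suc (suc (suc k))) hu with Adj⇒R hu
    ... | inj₁ (inj₁ (() , _))
    ... | inj₁ (inj₂ (_ , s≤s (s≤s ())))
    ... | inj₂ (inj₁ (() , _))
    ... | inj₂ (inj₂ (() , _))

    N[r₁] : N[ r₁ ]⊆⁅ h ⁆∪⁅ r₂ ⁆
    N[r₁] zero _ = inj₁ refl
    N[r₁] (suc zero) r₁r₁ = ⊥-elim (irrefl r₁r₁)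
    N[r₁] (suc (suc zero)) _ = inj₂ refl
    N[r₁] (suc (suc (suc k))) r₁u with Adj⇒R r₁u
    ... | inj₁ (inj₁ (() , _))
    ... | inj₁ (inj₂ (() , _))
    ... | inj₂ (inj₁ (() , _))
    ... | inj₂ (inj₂ (() , _))

    N[r₂] : N[ r₂ ]⊆⁅ h ⁆∪⁅ r₁ ⁆
    N[r₂] zero _ = inj₁ refl
    N[r₂] (suc zero) _ = inj₂ refl
    N[r₂] (suc (suc zero)) r₂r₂ = ⊥-elim (irrefl r₂r₂)
    N[r₂] (suc (suc (suc k))) r₂u with Adj⇒R r₂u
    ... | inj₁ (inj₁ (_ , ()))
    ... | inj₁ (inj₂ (() , _))
    ... | inj₂ (inj₁ (() , _))
    ... | inj₂ (inj₂ (() , _))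

    outer-leaf-partner : (k : Fin (suc m)) → let v = suc (suc (suc k)) in ∃[ w ] (Adj deletion v w × N[ w ]⊆⁅ v ⁆)
    outer-leaf-partner k with matched-partner (subst (_≢ 1ℙ) (sym n-even) (λ ())) (suc (suc (suc k))) (inj₂ λ ())
    ... | w , vw = w , matched-adj inj₁ vw , matched-leaf only-matched vw
      where
      3≤w : 3 ≤ toℕ w
      3≤w = partner-of-outer (s≤s (s≤s (s≤s z≤n))) vw
      only-matched : ∀ {u} → TriangleMatching (w , u) ⊎ TriangleMatching (u , w) → Partners 1ℙ w u
      only-matched (inj₁ (inj₁ wu)) = inj₁ wu
      only-matched (inj₂ (inj₁ uw)) = inj₂ uw
      only-matched (inj₁ (inj₂ (w≡0 , _))) = ⊥-elim (<⇒≢ (≤-trans (s≤s z≤n) 3≤w) (sym w≡0))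
      only-matched (inj₂ (inj₂ (_ , w≤2))) = ⊥-elim (<⇒≱ 3≤w w≤2)

    no-isolated : NoIsolated (WheelMinus n deletion)
    no-isolated zero = r₁ , h-r₁
    no-isolated (suc zero) = h , Adj-sym deletion h-r₁
    no-isolated (suc (suc zero)) = h , Adj-sym deletion h-r₂
    no-isolated (suc (suc (suc k))) = proj₁ (outer-leaf-partner k) , proj₁ (proj₂ (outer-leaf-partner k))

    outer-supported : ∀ v → v ≢ h → v ≢ r₁ → v ≢ r₂ → Support v
    outer-supported zero v≢h _ _ = ⊥-elim (v≢h refl)
    outer-supported (suc zero) _ v≢r₁ _ = ⊥-elim (v≢r₁ refl)
    outer-supported (suc (suc zero)) _ _ v≢r₂ = ⊥-elim (v≢r₂ refl)
    outer-supported (suc (suc (suc k))) _ _ _ = proj₁ (outer-leaf-partner k) , proj₂ (proj₂ (outer-leaf-partner k))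

    good : GoodDeletion n (n ∸ 2) deletion
    good = no-isolated , λ g γt S tds → subst (λ g → g + (n ∸ 2) ≤ ∣ S ∣) (sym (γt[Wheel]-unique γt))
      (Closed⇒V∸1≤∣TDS∣ (N[h] , N[r₁] , N[r₂]) outer-supported tds)

    deleted≤bound : ∣ deletion ∣ ≤ 2 * n ∸ (n + 4) / 2
    deleted≤bound = deleted≤ deletion (begin
      n + 4                                                    ≡⟨ +-suc n 3 ⟩
      suc n + 3                                                ≡⟨ ∑[1+𝟙+𝟙+𝟙]≡n+3 h r₁ r₂ ⟨
      ∑[ v < suc n ] (1 + 𝟙 (v ≟ h) + 𝟙 (v ≟ r₁) + 𝟙 (v ≟ r₂))  ≤⟨ sum-mono triangle-degrees ⟩
      ∑[ v < suc n ] degree v                                  ≡⟨ ∑degree≡2*kept deletion ⟩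
      2 * ∣ ∁ deletion ∣                                       ∎)
      where
      open ≤-Reasoning
      triangle-degrees : ∀ v → 1 + 𝟙 (v ≟ h) + 𝟙 (v ≟ r₁) + 𝟙 (v ≟ r₂) ≤ degree v
      triangle-degrees zero = degree≥2 (λ ()) h-r₁ h-r₂
      triangle-degrees (suc zero) = degree≥2 (λ ()) (Adj-sym deletion h-r₁) r₁-r₂
      triangle-degrees (suc (suc zero)) = degree≥2 (λ ()) (Adj-sym deletion h-r₂) (Adj-sym deletion r₁-r₂)
      triangle-degrees v@(suc (suc (suc _))) = degree≥1 (proj₂ (no-isolated v))

  bondage[n∸2] : parity n ≡ 0ℙ → IsBondageT n (n ∸ 2) (2 * n ∸ (n + 4) / 2)
  bondage[n∸2] n-even =
    (deletion , good , ≤-antisym deleted≤bound (good-deletion[n∸2]⇒∣D∣≥ deletion good)) , good-deletion[n∸2]⇒∣D∣≥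
    where open TriangleAndMatching n-even

theorem3p8 : (n : ℕ) → 3 ≤ n →
    ((2 ∣ n) → IncreaseAtMost n (n ∸ 2) × IsBondageT n (n ∸ 2) (2 * n ∸ (n + 4) / 2)) ×
    (¬ (2 ∣ n) → IncreaseAtMost n (n ∸ 1) × IsBondageT n (n ∸ 1) (2 * n ∸ (n + 1) / 2))
theorem3p8 (suc (suc (suc m))) _ =
  (λ 2∣n → increase≤n∸2 2∣n , bondage[n∸2] (2∣⇒parity≡0ℙ 2∣n)) ,
  (λ ¬2∣n → increase≤n∸1 , bondage[n∸1] (¬2∣n ∘ parity≡0ℙ⇒2∣ _))
  where open WheelBondage m
theorem3p8 0 ()
theorem3p8 1 (s≤s ())
theorem3p8 2 (s≤s (s≤s ()))
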